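{- Let $\mathbf{a}<\mathbf{b}$ be two positive co-prime integers, $k$ a positive integer, and $\widetilde S$ the sumset semigroup generated by $\{0,k\mathbf{a}\}$ and $\{0,k\mathbf{b}\}$, with ideal $I_{\widetilde S}\subset\mathbf{k}[x,y]$ ($x$ corresponding to $\{0,k\mathbf{a}\}$, $y$ to $\{0,k\mathbf{b}\}$). Let $x^\alpha y^\beta-x^\gamma y^\delta\in I_{\widetilde S}\setminus\{0\}$ with $\alpha>\gamma$. Then $\gamma\ge\mathbf{b}-1$, $\beta\ge\mathbf{a}-1$, and there is a positive integer $n$ such that $x^\alpha y^\beta-x^\gamma y^\delta=x^\gamma y^\beta(x^{n\mathbf{b}}-y^{n\mathbf{a}})$.
   Context: For finite non-empty $A,B\subset\mathbb{N}$, $A+B=\{a+b\mid a\in A,b\in B\}$, and $\alpha\otimes A$ is the $\alpha$-fold sum of $A$ with itself ($0\otimes A=\{0\}$). The ideal of the sumset semigroup generated by $A_1,A_2$ is the binomial ideal $I\subset\mathbf{k}[x,y]$ ($\mathbf{k}$ a field) generated by all $x^{\alpha_1}y^{\alpha_2}-x^{\beta_1}y^{\beta_2}$ with $\alpha_1\otimes A_1+\alpha_2\otimes A_2=\beta_1\otimes A_1+\beta_2\otimes A_2$. -}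

module Defs where

open import Data.Nat using (ℕ; zero; suc; _+_; _*_)
open import Data.List using (List; []; _∷_; [_]; map; concatMap)
open import Data.List.Membership.Propositional using (_∈_)
open import Data.Product using (_×_)

-- Finite subsets of ℕ are represented by lists (duplicates / order irrelevant;
-- sets are compared by membership).

_⊕_ : List ℕ → List ℕ → List ℕ
A ⊕ B = concatMap (λ a → map (a +_) B) A

infixl 6 _⊕_
infixr 7 _⊗_

_⊗_ : ℕ → List ℕ → List ℕ
zero ⊗ A = [ 0 ]
suc n ⊗ A = A ⊕ (n ⊗ A)

SameSet : List ℕ → List ℕ → Set
SameSet A B = ∀ n → (n ∈ A → n ∈ B) × (n ∈ B → n ∈ A)

-- The defining relation of the sumset semigroup generated by A₁, A₂:
-- x^α₁ y^α₂ - x^β₁ y^β₂ is a generator of the ideal I iff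
-- α₁ ⊗ A₁ + α₂ ⊗ A₂ = β₁ ⊗ A₁ + β₂ ⊗ A₂.
SumsetRel : List ℕ → List ℕ → ℕ → ℕ → ℕ → ℕ → Set
SumsetRel A₁ A₂ α₁ α₂ β₁ β₂ =
  SameSet (α₁ ⊗ A₁ ⊕ α₂ ⊗ A₂) (β₁ ⊗ A₁ ⊕ β₂ ⊗ A₂)

{-# OPTIONS --safe #-}
module Submission where

open import Defs
open import Data.Nat using (ℕ; zero; suc; _+_; _*_; _∸_; _<_; _≤_; z≤n; s≤s; >-nonZero)
open import Data.Nat.Properties
open import Data.Nat.Coprimality using (Coprime; coprime-divisor)
import Data.Nat.Coprimality as Coprime
open import Data.Nat.Divisibility using (_∣_; divides; ∣⇒≤)
open import Data.Nat.Tactic.RingSolver using (solve-∀)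
open import Data.List using (_∷_; []; map)
open import Data.List.Membership.Propositional using (_∈_; find; lose)
open import Data.List.Membership.Propositional.Properties
  using (∈-concatMap⁺; ∈-concatMap⁻; ∈-map⁺; ∈-map⁻)
open import Data.List.Relation.Unary.Any using (here; there)
open import Data.Product using (_×_; ∃-syntax; _,_; proj₁; proj₂)
open import Relation.Nullary using (contradiction)
open import Function using (_∘_)
open import Relation.Binary.PropositionalEquality
  using (_≡_; refl; sym; trans; cong; subst; module ≡-Reasoning)

-- Every element of α ⊗ {0, ka} + β ⊗ {0, kb} is k (i a + j b) with i ≤ α, j ≤ β,
-- so a relation of the sumset semigroup says that the boxes [0, α] × [0, β] and
-- [0, γ] × [0, δ] produce the same combinations i a + j b.  Comparing maxima
-- gives α a + β b = γ a + δ b, and coprimality forces (α - γ, δ - β) = n (b, a).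
-- The element (γ + 1) a of the first box must be written with at most γ copies
-- of a, i.e. some positive multiple t a with t ≤ γ + 1 equals j b; then b ∣ t,
-- so b ≤ γ + 1.  Symmetrically (β + 1) b lies in the second box, giving a ≤ β + 1.

∈-⊕⁻ : ∀ {A B n} → n ∈ A ⊕ B → ∃[ x ] ∃[ y ] (x ∈ A × y ∈ B × n ≡ x + y)
∈-⊕⁻ {A} {B} n∈ with find (∈-concatMap⁻ (λ a → map (a +_) B) {xs = A} n∈)
... | x , x∈A , n∈x+B with ∈-map⁻ (x +_) n∈x+B
... | y , y∈B , n≡x+y = x , y , x∈A , y∈B , n≡x+y

∈-⊕⁺ : ∀ {A B x y} → x ∈ A → y ∈ B → x + y ∈ A ⊕ B
∈-⊕⁺ {B = B} {x} x∈A y∈B = ∈-concatMap⁺ (λ a → map (a +_) B) (lose x∈A (∈-map⁺ (x +_) y∈B))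

∈-⊕-comm : ∀ {A B n} → n ∈ A ⊕ B → n ∈ B ⊕ A
∈-⊕-comm {A} {B} n∈ with ∈-⊕⁻ {A} {B} n∈
... | x , y , x∈A , y∈B , refl = subst (_∈ B ⊕ A) (+-comm y x) (∈-⊕⁺ {B} {A} y∈B x∈A)

∈-⊗-pair⁻ : ∀ {c} α {n} → n ∈ α ⊗ (0 ∷ c ∷ []) → ∃[ i ] (i ≤ α × n ≡ i * c)
∈-⊗-pair⁻ zero    (here refl) = 0 , z≤n , refl
∈-⊗-pair⁻ {c} (suc α) n∈ with ∈-⊕⁻ {0 ∷ c ∷ []} {α ⊗ (0 ∷ c ∷ [])} n∈
... | _ , y , here refl         , y∈ , n≡y with ∈-⊗-pair⁻ α y∈
...   | i , i≤α , refl = i , m≤n⇒m≤1+n i≤α , n≡y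
∈-⊗-pair⁻ (suc α) n∈ | _ , y , there (here refl) , y∈ , n≡c+y with ∈-⊗-pair⁻ α y∈
...   | i , i≤α , refl = suc i , s≤s i≤α , n≡c+y
∈-⊗-pair⁻ (suc α) n∈ | _ , _ , there (there ()) , _

∈-⊗-pair⁺ : ∀ {c} α {i} → i ≤ α → i * c ∈ α ⊗ (0 ∷ c ∷ [])
∈-⊗-pair⁺     zero    z≤n       = here refl
∈-⊗-pair⁺ {c} (suc α) z≤n       =
  ∈-⊕⁺ {0 ∷ c ∷ []} {α ⊗ (0 ∷ c ∷ [])} (here refl) (∈-⊗-pair⁺ α z≤n)
∈-⊗-pair⁺ {c} (suc α) (s≤s i≤α) =
  ∈-⊕⁺ {0 ∷ c ∷ []} {α ⊗ (0 ∷ c ∷ [])} (there (here refl)) (∈-⊗-pair⁺ α i≤α)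

BoundedComb : (a b α β n : ℕ) → Set
BoundedComb a b α β n = ∃[ i ] ∃[ j ] (i ≤ α × j ≤ β × n ≡ i * a + j * b)

∈-sumset⁻ : ∀ {c d} α β {n} → n ∈ α ⊗ (0 ∷ c ∷ []) ⊕ β ⊗ (0 ∷ d ∷ []) → BoundedComb c d α β n
∈-sumset⁻ {c} {d} α β n∈ with ∈-⊕⁻ {α ⊗ (0 ∷ c ∷ [])} {β ⊗ (0 ∷ d ∷ [])} n∈
... | x , y , x∈ , y∈ , refl with ∈-⊗-pair⁻ {c} α x∈ | ∈-⊗-pair⁻ {d} β y∈
... | i , i≤α , refl | j , j≤β , refl = i , j , i≤α , j≤β , refl

∈-sumset⁺ : ∀ {c d} α β {n} → BoundedComb c d α β n → n ∈ α ⊗ (0 ∷ c ∷ []) ⊕ β ⊗ (0 ∷ d ∷ [])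
∈-sumset⁺ {c} {d} α β (i , j , i≤α , j≤β , refl) =
  ∈-⊕⁺ {α ⊗ (0 ∷ c ∷ [])} {β ⊗ (0 ∷ d ∷ [])} (∈-⊗-pair⁺ α i≤α) (∈-⊗-pair⁺ β j≤β)

*-distribˡ-combination : ∀ k i j a b → k * (i * a + j * b) ≡ i * (k * a) + j * (k * b)
*-distribˡ-combination = solve-∀

BoundedComb-*ˡ : ∀ {a b α β n} k → BoundedComb a b α β n → BoundedComb (k * a) (k * b) α β (k * n)
BoundedComb-*ˡ {a} {b} k (i , j , i≤α , j≤β , refl) =
  i , j , i≤α , j≤β , *-distribˡ-combination k i j a b

BoundedComb-cancelˡ : ∀ {a b α β n k} → 0 < k →
                      BoundedComb (k * a) (k * b) α β (k * n) → BoundedComb a b α β n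
BoundedComb-cancelˡ {a} {b} {n = n} {k} 0<k (i , j , i≤α , j≤β , kn≡) =
  i , j , i≤α , j≤β ,
  *-cancelˡ-≡ n _ k {{>-nonZero 0<k}} (trans kn≡ (sym (*-distribˡ-combination k i j a b)))

BoundedComb⇒≤ : ∀ {a b α β n} → BoundedComb a b α β n → n ≤ α * a + β * b
BoundedComb⇒≤ {a} {b} (i , j , i≤α , j≤β , refl) = +-mono-≤ (*-monoˡ-≤ a i≤α) (*-monoˡ-≤ b j≤β)

-- SumsetRel and BoundedComb unfold to Π- and Σ-types, so their indices cannot be
-- inferred from a proof; below they are passed explicitly.
SumsetRel-sym : ∀ {A₁ A₂ α β γ δ} → SumsetRel A₁ A₂ α β γ δ → SumsetRel A₁ A₂ γ δ α β
SumsetRel-sym R n = proj₂ (R n) , proj₁ (R n)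

SumsetRel-swap : ∀ {A₁ A₂ α β γ δ} → SumsetRel A₁ A₂ α β γ δ → SumsetRel A₂ A₁ β α δ γ
SumsetRel-swap {A₁} {A₂} {α} {β} {γ} {δ} R n =
  ∈-⊕-comm {γ ⊗ A₁} {δ ⊗ A₂} ∘ proj₁ (R n) ∘ ∈-⊕-comm {β ⊗ A₂} {α ⊗ A₁} ,
  ∈-⊕-comm {α ⊗ A₁} {β ⊗ A₂} ∘ proj₂ (R n) ∘ ∈-⊕-comm {δ ⊗ A₂} {γ ⊗ A₁}

SumsetRel⇒BoundedComb⊆ : ∀ {a b k α β γ δ n} → 0 < k →
                         SumsetRel (0 ∷ k * a ∷ []) (0 ∷ k * b ∷ []) α β γ δ →
                         BoundedComb a b α β n → BoundedComb a b γ δ n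
SumsetRel⇒BoundedComb⊆ {k = k} {α} {β} {γ} {δ} 0<k R c =
  BoundedComb-cancelˡ 0<k (∈-sumset⁻ γ δ (proj₁ (R _) (∈-sumset⁺ α β (BoundedComb-*ˡ k c))))

SumsetRel⇒max≡ : ∀ {a b k α β γ δ} → 0 < k →
                 SumsetRel (0 ∷ k * a ∷ []) (0 ∷ k * b ∷ []) α β γ δ →
                 α * a + β * b ≡ γ * a + δ * b
SumsetRel⇒max≡ {a} {b} {k} {α} {β} {γ} {δ} 0<k R = ≤-antisym
  (BoundedComb⇒≤ (SumsetRel⇒BoundedComb⊆ {a} {b} {k} {α} {β} {γ} {δ} 0<k R
                    (α , β , ≤-refl , ≤-refl , refl)))
  (BoundedComb⇒≤ (SumsetRel⇒BoundedComb⊆ {a} {b} {k} {γ} {δ} {α} {β} 0<k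
                    (SumsetRel-sym {α = α} {β} {γ} {δ} R) (γ , δ , ≤-refl , ≤-refl , refl)))

coprime-*≡*⇒∣ : ∀ {a b s d} → Coprime a b → s * a ≡ d * b → b ∣ s
coprime-*≡*⇒∣ {a} {s = s} {d} cop sa≡db =
  coprime-divisor (Coprime.sym cop) (divides d (trans (*-comm a s) sa≡db))

coprime-*≡*⇒multiple : ∀ {a b s d} → Coprime a b → 0 < b → s * a ≡ d * b →
                       ∃[ n ] (s ≡ n * b × d ≡ n * a)
coprime-*≡*⇒multiple {a} {b} {s} {d} cop 0<b sa≡db with coprime-*≡*⇒∣ {s = s} {d} cop sa≡db
... | divides n refl = n , refl , sym (*-cancelʳ-≡ (n * a) d b {{>-nonZero 0<b}} nab≡db)
  where
  nab≡db : n * a * b ≡ d * b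
  nab≡db = begin
    n * a * b    ≡⟨ *-assoc n a b ⟩
    n * (a * b)  ≡⟨ cong (n *_) (*-comm a b) ⟩
    n * (b * a)  ≡⟨ *-assoc n b a ⟨
    n * b * a    ≡⟨ sa≡db ⟩
    d * b        ∎
    where open ≡-Reasoning

coprime-exchange⇒≤ : ∀ {a b i j m} → Coprime a b → i < m → m * a ≡ i * a + j * b → b ≤ m
coprime-exchange⇒≤ {a} {b} {i} {j} {m} cop i<m ma≡ =
  ≤-trans (∣⇒≤ {{>-nonZero (m<n⇒0<n∸m i<m)}} (coprime-*≡*⇒∣ {d = j} cop [m∸i]a≡jb)) (m∸n≤m m i)
  where
  open ≡-Reasoning
  [m∸i]a≡jb : (m ∸ i) * a ≡ j * b
  [m∸i]a≡jb = begin
    (m ∸ i) * a            ≡⟨ *-distribʳ-∸ a m i ⟩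
    m * a ∸ i * a          ≡⟨ cong (_∸ i * a) ma≡ ⟩
    i * a + j * b ∸ i * a  ≡⟨ m+n∸m≡n (i * a) (j * b) ⟩
    j * b                  ∎

coprime-*+*≡*⇒multiple : ∀ {a b s β δ} → Coprime a b → 0 < b → s * a + β * b ≡ δ * b →
                         ∃[ n ] (s ≡ n * b × δ ≡ β + n * a)
coprime-*+*≡*⇒multiple {a} {b} {s} {β} {δ} cop 0<b eq with m≤n⇒∃[o]m+o≡n β≤δ
  where
  β≤δ : β ≤ δ
  β≤δ = *-cancelʳ-≤ β δ b {{>-nonZero 0<b}} (subst (β * b ≤_) eq (m≤n+m (β * b) (s * a)))
... | d , refl with coprime-*≡*⇒multiple cop 0<b sa≡db
  where
  sa≡db : s * a ≡ d * b
  sa≡db = +-cancelʳ-≡ (β * b) _ _ (trans eq (trans (*-distribʳ-+ b β d) (+-comm (β * b) (d * b))))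
... | n , s≡nb , d≡na = n , s≡nb , cong (β +_) d≡na

combination-≡⇒shift : ∀ {a b α β γ δ} → Coprime a b → 0 < b → γ < α →
                      α * a + β * b ≡ γ * a + δ * b →
                      ∃[ n ] (0 < n × α ≡ γ + n * b × δ ≡ β + n * a)
combination-≡⇒shift {a} {b} {α} {β} {γ} {δ} cop 0<b γ<α eq with m≤n⇒∃[o]m+o≡n (<⇒≤ γ<α)
... | s , refl with coprime-*+*≡*⇒multiple {s = s} {β} {δ} cop 0<b sa+βb≡δb
  where
  open ≡-Reasoning
  sa+βb≡δb : s * a + β * b ≡ δ * b
  sa+βb≡δb = +-cancelˡ-≡ (γ * a) _ _ (begin
    γ * a + (s * a + β * b)  ≡⟨ +-assoc (γ * a) (s * a) (β * b) ⟨
    γ * a + s * a + β * b    ≡⟨ cong (_+ β * b) (*-distribʳ-+ a γ s) ⟨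
    (γ + s) * a + β * b      ≡⟨ eq ⟩
    γ * a + δ * b            ∎)
... | zero  , refl , _    = contradiction (sym (+-identityʳ γ)) (<⇒≢ γ<α)
... | suc n , refl , δ≡ = suc n , s≤s z≤n , refl , δ≡

SumsetRel-exchange-≤ : ∀ {a b k α β γ δ} → 0 < k → Coprime a b →
                       SumsetRel (0 ∷ k * a ∷ []) (0 ∷ k * b ∷ []) α β γ δ → γ < α → b ≤ suc γ
SumsetRel-exchange-≤ {a} {b} {k} {α} {β} {γ} {δ} 0<k cop R γ<α =
  exchange (SumsetRel⇒BoundedComb⊆ {a} {b} {k} {α} {β} {γ} {δ} 0<k R
             (suc γ , 0 , γ<α , z≤n , sym (+-identityʳ (suc γ * a))))
  where
  exchange : BoundedComb a b γ δ (suc γ * a) → b ≤ suc γ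
  exchange (i , j , i≤γ , _ , eq) = coprime-exchange⇒≤ {j = j} cop (s≤s i≤γ) eq

lemma8 : (a b k : ℕ) → 0 < a → a < b → Coprime a b → 0 < k →
         (α β γ δ : ℕ) →
         SumsetRel (0 ∷ k * a ∷ []) (0 ∷ k * b ∷ []) α β γ δ →
         γ < α →
         (b ∸ 1 ≤ γ) × (a ∸ 1 ≤ β) ×
         (∃[ n ] (0 < n × α ≡ γ + n * b × δ ≡ β + n * a))
lemma8 a b k 0<a a<b cop 0<k α β γ δ R γ<α =
  ∸-monoˡ-≤ 1 (SumsetRel-exchange-≤ {a} {b} {k} {α} {β} {γ} {δ} 0<k cop R γ<α) ,
  ∸-monoˡ-≤ 1 (SumsetRel-exchange-≤ {b} {a} {k} {δ} {γ} {β} {α} 0<k (Coprime.sym cop) R′ β<δ) ,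
  shift
  where
  0<b : 0 < b
  0<b = m<n⇒0<n a<b
  R′ : SumsetRel (0 ∷ k * b ∷ []) (0 ∷ k * a ∷ []) δ γ β α
  R′ = SumsetRel-swap {α = γ} {δ} {α} {β} (SumsetRel-sym {α = α} {β} {γ} {δ} R)
  shift : ∃[ n ] (0 < n × α ≡ γ + n * b × δ ≡ β + n * a)
  shift = combination-≡⇒shift cop 0<b γ<α (SumsetRel⇒max≡ {a} {b} {k} {α} {β} {γ} {δ} 0<k R)
  β<δ : β < δ
  β<δ = let n , 0<n , _ , δ≡ = shift in subst (β <_) (sym δ≡) (m<m+n β (*-mono-< 0<n 0<a))
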